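{- Let $t,k\ge 2$ be given integers. Then ${\rm forb}(m,\{t\cdot I_k,\,t\cdot I_k^c,\,t\cdot T_k\})$ is $\Theta(m)$ as $m\to\infty$.
   Context: A matrix is simple if it is a (0,1)-matrix with no repeated columns. For (0,1)-matrices $F$ and $A$, $F\prec A$ means some row and column permutation of $F$ is a submatrix of $A$. For a finite family $\mathcal F$ of (0,1)-matrices, ${\rm forb}(m,\mathcal F)$ is the maximum number of columns of an $m$-rowed simple matrix $A$ with $F\not\prec A$ for every $F\in\mathcal F$. $t\cdot M$ denotes the concatenation of $t$ copies of $M$. $I_k$ is the $k\times k$ identity matrix, $I_k^c$ its (0,1)-complement, and $T_k$ is the $k\times k$ (0,1)-matrix whose $(i,j)$ entry is 1 if and only if $i\le j$. -}

module Defs where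

open import Data.Nat using (ℕ; _*_; _≤ᵇ_)
open import Data.Bool using (Bool; not)
open import Data.Fin using (Fin; toℕ; remainder; _≟_)
open import Data.Product using (Σ; _×_)
open import Relation.Nullary.Decidable using (⌊_⌋)
open import Relation.Binary.PropositionalEquality using (_≡_)
open import Function.Definitions using (Injective)

Mat : ℕ → ℕ → Set
Mat m n = Fin m → Fin n → Bool

Simple : ∀ {m n} → Mat m n → Set
Simple {m} {n} A = (j j′ : Fin n) → ((i : Fin m) → A i j ≡ A i j′) → j ≡ j′

-- F ≺ A : some row and column permutation of F is a submatrix of A,
-- i.e. there are injective row and column maps embedding F into A.
_≺_ : ∀ {k l m n} → Mat k l → Mat m n → Set
_≺_ {k} {l} {m} {n} F A =
  Σ (Fin k → Fin m) λ r → Σ (Fin l → Fin n) λ c →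
    Injective _≡_ _≡_ r × Injective _≡_ _≡_ c ×
    ((i : Fin k) (j : Fin l) → A (r i) (c j) ≡ F i j)

-- t · M : concatenation of t copies of M (column j of t·M is column (j mod l) of M)
_·_ : ∀ {k l} (t : ℕ) → Mat k l → Mat k (t * l)
(t · M) i j = M i (remainder {t} _ j)

I : (k : ℕ) → Mat k k
I k i j = ⌊ i ≟ j ⌋

Iᶜ : (k : ℕ) → Mat k k
Iᶜ k i j = not (I k i j)

T : (k : ℕ) → Mat k k
T k i j = toℕ i ≤ᵇ toℕ j

module Submission where

-- Lower bound: I_m is simple and contains no t·F with a 1 in F, since two copies of that 1
-- would need two columns of I_m with a 1 in the same row.
-- Upper bound: let A be simple, m × n, avoiding the three matrices.  Call a class of columns
-- agreeing on the first ρ rows large if it has at least t members.  Counting through large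
-- classes gives n ≤ t + t · #(large classes of depth < m).  At each depth there are at most
-- N = 2^(2^(4k+4)) large classes: their representatives are distinguished by the first ρ rows,
-- so by the Balogh–Bollobás theorem more of them would contain I_k, I_k^c or T_k, and t members
-- of each class would give t·I_k, t·I_k^c or t·T_k in A.  Hence n ≤ t(N+1)·m.

open import Defs
open import Data.Nat using (ℕ; _*_; _≤_)
open import Data.Product using (Σ; _×_)
open import Relation.Nullary using (¬_)

open import Data.Nat using (zero; suc; _+_; _^_; _<_; z≤n; s≤s; _≤?_; _<?_; _≤ᵇ_)
open import Data.Nat.Properties
open import Data.Nat.Tactic.RingSolver using (solve-∀)
open import Algebra.Properties.CommutativeSemigroup +-commutativeSemigroup
  using () renaming (interchange to +-interchange)
open import Data.Bool using (Bool; true; false; not)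
open import Data.Bool.Properties using () renaming (_≟_ to _≟ᵇ_)
open import Data.Fin as Fin using (Fin; toℕ)
import Data.Fin.Properties as Finₚ
open import Data.List using (List; []; _∷_; _++_; length; filter; lookup; map; allFin)
open import Data.List.Properties using (length-++; length-map; length-tabulate)
open import Data.List.Membership.Propositional using (_∈_)
open import Data.List.Relation.Unary.Unique.Propositional using (Unique)
open import Data.List.Relation.Unary.Unique.Propositional.Properties using (allFin⁺)
open import Data.List.Membership.Propositional.Properties using (∈-filter⁻; ∈-lookup; ∈-map⁻)
open import Data.List.Relation.Binary.Sublist.Propositional using (_⊆_; []; _∷_; _∷ʳ_; minimum; ⊆-trans)
open import Data.List.Relation.Binary.Sublist.Propositional.Properties using (All-resp-⊆; filter-⊆)
open import Data.List.Relation.Unary.All as All using (All; []; _∷_)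
open import Data.List.Relation.Unary.All.Properties as All using (all-filter)
open import Data.List.Relation.Unary.AllPairs as AllPairs using (AllPairs; []; _∷_)
import Data.List.Relation.Unary.AllPairs.Properties as AllPairs
open import Data.List.Relation.Unary.Any using (here; there)
open import Data.Product using (_,_; proj₁; proj₂)
open import Data.Sum using (_⊎_; inj₁; inj₂)
open import Data.Empty using (⊥; ⊥-elim)
open import Data.Unit using (⊤; tt)
open import Relation.Binary.Definitions using (tri<; tri≈; tri>)
open import Relation.Binary.PropositionalEquality
open import Relation.Nullary using (yes; no)
open import Relation.Nullary.Decidable using (dec-true; dec-false)
open import Function using (_∘_)
open import Function.Definitions using (Injective)

private
  variable
    A : Set
    xs : List A

select : (A → Bool) → Bool → List A → List A
select f b = filter (λ x → f x ≟ᵇ b)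

select-sound : ∀ (f : A → Bool) b xs → All (λ x → f x ≡ b) (select f b xs)
select-sound f b = all-filter (λ x → f x ≟ᵇ b)

select-∈ : ∀ (f : A → Bool) b xs {x} → x ∈ select f b xs → x ∈ xs × f x ≡ b
select-∈ f b xs = ∈-filter⁻ (λ x → f x ≟ᵇ b)

select-length : ∀ (f : A → Bool) b xs →
  length (select f b xs) + length (select f (not b) xs) ≡ length xs
select-length f b [] = refl
select-length f b (x ∷ xs) with f x | b
... | true  | true  = cong suc (select-length f true xs)
... | false | false = cong suc (select-length f false xs)
... | true  | false = trans (+-suc _ _) (cong suc (select-length f false xs))
... | false | true  = trans (+-suc _ _) (cong suc (select-length f true xs))

majority : ∀ (f : A → Bool) xs →
  Σ Bool λ b → length (select f (not b) xs) ≤ length (select f b xs)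
majority f xs with ≤-total (length (select f true xs)) (length (select f false xs))
... | inj₁ t≤f = false , t≤f
... | inj₂ f≤t = true , f≤t

halve : ∀ {K p q} → K + K ≤ p + q → q ≤ p → K ≤ p
halve {K} {p} {q} 2K≤p+q q≤p = *-cancelˡ-≤ 2 (begin
  2 * K      ≡⟨ cong (K +_) (+-identityʳ K) ⟩
  K + K      ≤⟨ 2K≤p+q ⟩
  p + q      ≤⟨ +-monoʳ-≤ p q≤p ⟩
  p + p      ≡⟨ cong (p +_) (sym (+-identityʳ p)) ⟩
  2 * p      ∎)
  where open ≤-Reasoning

majority-large : ∀ (f : A → Bool) xs {K} → K + K ≤ length xs →
  Σ Bool λ b → K ≤ length (select f b xs)
majority-large f xs K+K≤ with majority f xs
... | b , minor≤major =
  b , halve (≤-trans K+K≤ (≤-reflexive (sym (select-length f b xs)))) minor≤major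

double : ∀ L → 2 ^ suc L ≡ 2 ^ L + 2 ^ L
double L = cong (2 ^ L +_) (+-identityʳ (2 ^ L))

two≤2^suc : ∀ L → 2 ≤ 2 ^ suc L
two≤2^suc L = *-monoʳ-≤ 2 (m^n>0 2 L)

AllPairs-refine : ∀ {P : A → Set} {R R′ : A → A → Set} →
  (∀ {x y} → P x → P y → R x y → R′ x y) → All P xs → AllPairs R xs → AllPairs R′ xs
AllPairs-refine f [] [] = []
AllPairs-refine f (px ∷ pxs) (rx ∷ rxs) =
  All.zipWith (λ (py , r) → f px py r) (pxs , rx) ∷ AllPairs-refine f pxs rxs

AllPairs-resp-⊆ : ∀ {R : A → A → Set} {ys} → xs ⊆ ys → AllPairs R ys → AllPairs R xs
AllPairs-resp-⊆ [] [] = []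
AllPairs-resp-⊆ (y ∷ʳ τ) (_ ∷ rys) = AllPairs-resp-⊆ τ rys
AllPairs-resp-⊆ (refl ∷ τ) (ry ∷ rys) = All-resp-⊆ τ ry ∷ AllPairs-resp-⊆ τ rys

AllPairs-lookup : ∀ {R : A → A → Set} → AllPairs R xs → ∀ {i j} → i Fin.< j →
  R (lookup xs i) (lookup xs j)
AllPairs-lookup (rx ∷ _) {Fin.zero} {Fin.suc j} _ = All.lookup rx (∈-lookup j)
AllPairs-lookup (_ ∷ rxs) {Fin.suc i} {Fin.suc j} (s≤s i<j) = AllPairs-lookup rxs i<j

lookup-injective : Unique xs → ∀ {i j} → lookup xs i ≡ lookup xs j → i ≡ j
lookup-injective distinct {i} {j} eq with Finₚ.<-cmp i j
... | tri< i<j _ _ = ⊥-elim (AllPairs-lookup distinct i<j eq)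
... | tri≈ _ i≡j _ = i≡j
... | tri> _ _ j<i = ⊥-elim (AllPairs-lookup distinct j<i (sym eq))

AllPairs-collapse : ∀ {R : A → A → Set} → (∀ {x y} → R x y → R y x) →
  AllPairs (λ x y → ¬ R x y) xs → ∀ {x y} → x ∈ xs → y ∈ xs → R x y → x ≡ y
AllPairs-collapse sym-R (_ ∷ _) (here refl) (here refl) _ = refl
AllPairs-collapse sym-R (nr ∷ _) (here refl) (there y∈) r = ⊥-elim (All.lookup nr y∈ r)
AllPairs-collapse sym-R (nr ∷ _) (there x∈) (here refl) r = ⊥-elim (All.lookup nr x∈ (sym-R r))
AllPairs-collapse sym-R (_ ∷ nrs) (there x∈) (there y∈) r = AllPairs-collapse sym-R nrs x∈ y∈ r

-- Colour each ordered pair (x before y) of a list by `c x y`.  From a list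
-- with 2^M ≤ 1 + length there is a sublist of length M in which the colour of a pair depends
-- only on its earlier element; that colour is recorded next to the element.  Keep the first
-- element and continue in the larger colour class of its later elements.
Thinned : (A → A → Bool) → ℕ → List A → Set
Thinned {A} c M xs = Σ (List (A × Bool)) λ ys → M ≤ length ys × map proj₁ ys ⊆ xs ×
  AllPairs (λ u v → c (proj₁ u) (proj₁ v) ≡ proj₂ u) ys

ramsey : ∀ (c : A → A → Bool) M (xs : List A) → 2 ^ M ≤ suc (length xs) → Thinned c M xs
ramsey c zero xs _ = [] , z≤n , minimum xs , []
ramsey c (suc M) [] big = ⊥-elim (<-irrefl refl (≤-trans (two≤2^suc M) big))
ramsey c (suc M) (x ∷ xs) big with majority (c x) xs
... | b , minor≤major = extend (ramsey c M (select (c x) b xs) major-big)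
  where
  major-big : 2 ^ M ≤ suc (length (select (c x) b xs))
  major-big = halve (≤-trans (≤-reflexive (sym (double M))) (≤-trans big (≤-reflexive (begin
    suc (suc (length xs))
      ≡⟨ cong (λ l → suc (suc l)) (sym (select-length (c x) b xs)) ⟩
    suc (suc (length (select (c x) b xs) + length (select (c x) (not b) xs)))
      ≡⟨ cong suc (sym (+-suc _ _)) ⟩
    suc (length (select (c x) b xs)) + suc (length (select (c x) (not b) xs)) ∎))))
    (s≤s minor≤major)
    where open ≡-Reasoning
  extend : Thinned c M (select (c x) b xs) → Thinned c (suc M) (x ∷ xs)
  extend (ys , len , ys⊆ , hom) =
    (x , b) ∷ ys , s≤s len , refl ∷ ⊆-trans ys⊆ (filter-⊆ _ xs) ,
    All.map⁻ (All-resp-⊆ ys⊆ (select-sound (c x) b xs)) ∷ hom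

-- The triangle matrices.  tri P Γ m n is P above the diagonal (m < n), not P on it and Γ below
-- it.  Up to deleting a row and a column, or reversing the order, each of I_k, I_k^c and T_k is
-- one of them, and conversely every triangle matrix contains one of the three.

tri : Bool → Bool → ℕ → ℕ → Bool
tri P Γ zero    zero    = not P
tri P Γ zero    (suc n) = P
tri P Γ (suc m) zero    = Γ
tri P Γ (suc m) (suc n) = tri P Γ m n

tri-above : ∀ {P Γ m n} → m < n → tri P Γ m n ≡ P
tri-above {m = zero}  {suc n} _         = refl
tri-above {m = suc m} {suc n} (s≤s m<n) = tri-above m<n

tri-diagonal : ∀ {P Γ} m → tri P Γ m m ≡ not P
tri-diagonal zero    = refl
tri-diagonal (suc m) = tri-diagonal m

tri-below : ∀ {P Γ m n} → n < m → tri P Γ m n ≡ Γ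
tri-below {m = suc m} {zero}  _         = refl
tri-below {m = suc m} {suc n} (s≤s n<m) = tri-below n<m

tri-off-diagonal : ∀ {P} m n → ¬ m ≡ n → tri P P m n ≡ P
tri-off-diagonal zero    zero    m≢n = ⊥-elim (m≢n refl)
tri-off-diagonal zero    (suc n) _   = refl
tri-off-diagonal (suc m) zero    _   = refl
tri-off-diagonal (suc m) (suc n) m≢n = tri-off-diagonal m n (m≢n ∘ cong suc)

Tri : Bool → Bool → (ℓ : ℕ) → Mat ℓ ℓ
Tri P Γ ℓ x y = tri P Γ (toℕ x) (toℕ y)

transpose : ∀ {k l} → Mat k l → Mat l k
transpose F j i = F i j

not-≢ : ∀ {b} → ¬ not b ≡ b
not-≢ {true}  ()
not-≢ {false} ()

-- Columns y < y′ of a triangle matrix differ in row y, rows x < x′ differ in column x′.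
Tri-simple : ∀ {P Γ ℓ} → Simple (Tri P Γ ℓ)
Tri-simple y y′ same with <-cmp (toℕ y) (toℕ y′)
... | tri< y<y′ _ _ = ⊥-elim (not-≢ (trans (sym (tri-diagonal (toℕ y))) (trans (same y) (tri-above y<y′))))
... | tri≈ _ y≡y′ _ = Finₚ.toℕ-injective y≡y′
... | tri> _ _ y′<y = ⊥-elim (not-≢ (trans (sym (tri-diagonal (toℕ y′))) (trans (sym (same y′)) (tri-above y′<y))))

Tri-rows-simple : ∀ {P Γ ℓ} → Simple (transpose (Tri P Γ ℓ))
Tri-rows-simple x x′ same with <-cmp (toℕ x) (toℕ x′)
... | tri< x<x′ _ _ = ⊥-elim (not-≢ (trans (sym (tri-diagonal (toℕ x′))) (trans (sym (same x′)) (tri-above x<x′))))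
... | tri≈ _ x≡x′ _ = Finₚ.toℕ-injective x≡x′
... | tri> _ _ x′<x = ⊥-elim (not-≢ (trans (sym (tri-diagonal (toℕ x))) (trans (same x) (tri-above x′<x))))

≡⇒≺ : ∀ {k} {F G : Mat k k} → (∀ i j → G i j ≡ F i j) → F ≺ G
≡⇒≺ same = (λ i → i) , (λ j → j) , (λ e → e) , (λ e → e) , same

I-in-Tri : ∀ k → I k ≺ Tri false false k
I-in-Tri k = ≡⇒≺ entry
  where
  entry : ∀ i j → tri false false (toℕ i) (toℕ j) ≡ I k i j
  entry i j with i Fin.≟ j
  ... | yes refl = tri-diagonal (toℕ i)
  ... | no i≢j   = tri-off-diagonal (toℕ i) (toℕ j) (i≢j ∘ Finₚ.toℕ-injective)

Iᶜ-in-Tri : ∀ k → Iᶜ k ≺ Tri true true k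
Iᶜ-in-Tri k = ≡⇒≺ entry
  where
  entry : ∀ i j → tri true true (toℕ i) (toℕ j) ≡ Iᶜ k i j
  entry i j with i Fin.≟ j
  ... | yes refl = tri-diagonal (toℕ i)
  ... | no i≢j   = tri-off-diagonal (toℕ i) (toℕ j) (i≢j ∘ Finₚ.toℕ-injective)

Tri-shrink : ∀ {P Γ} k → Tri P Γ k ≺ Tri P Γ (suc k)
Tri-shrink {P} {Γ} k = Fin.inject₁ , Fin.inject₁ , Finₚ.inject₁-injective , Finₚ.inject₁-injective ,
  λ i j → cong₂ (tri P Γ) (Finₚ.toℕ-inject₁ i) (Finₚ.toℕ-inject₁ j)

≤ᵇ-true : ∀ {m n} → m ≤ n → (m ≤ᵇ n) ≡ true
≤ᵇ-true {m} {n} = dec-true (m ≤? n)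

≤ᵇ-false : ∀ {m n} → n < m → (m ≤ᵇ n) ≡ false
≤ᵇ-false {m} {n} n<m = dec-false (m ≤? n) (<⇒≱ n<m)

-- T_k is the triangle matrix with P = true and Γ = false after shifting the columns by one …
T-in-Tri-above : ∀ k → T k ≺ Tri true false (suc k)
T-in-Tri-above k = Fin.inject₁ , Fin.suc , Finₚ.inject₁-injective , Finₚ.suc-injective , entry
  where
  entry : ∀ i j → tri true false (toℕ (Fin.inject₁ i)) (suc (toℕ j)) ≡ T k i j
  entry i j rewrite Finₚ.toℕ-inject₁ i with <-cmp (toℕ i) (toℕ j)
  ... | tri< i<j _ _ = trans (tri-above (s≤s (<⇒≤ i<j))) (sym (≤ᵇ-true (<⇒≤ i<j)))
  ... | tri≈ _ i≡j _ = trans (tri-above (s≤s (≤-reflexive i≡j))) (sym (≤ᵇ-true (≤-reflexive i≡j)))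
  ... | tri> _ _ j<i with m≤n⇒m<n∨m≡n j<i
  ...   | inj₁ 1+j<i = trans (tri-below 1+j<i) (sym (≤ᵇ-false j<i))
  ...   | inj₂ 1+j≡i = trans (cong (λ m → tri true false m (suc (toℕ j))) (sym 1+j≡i))
                           (trans (tri-diagonal (suc (toℕ j))) (sym (≤ᵇ-false j<i)))

-- … and the triangle matrix with P = false and Γ = true after reversing both orders.
T-in-Tri-below : ∀ k → T k ≺ Tri false true k
T-in-Tri-below k = Fin.opposite , Fin.opposite , opposite-injective , opposite-injective , entry
  where
  opposite-injective : ∀ {i j : Fin k} → Fin.opposite i ≡ Fin.opposite j → i ≡ j
  opposite-injective {i} {j} e =
    trans (sym (Finₚ.opposite-involutive i)) (trans (cong Fin.opposite e) (Finₚ.opposite-involutive j))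
  reverses : ∀ {i j : Fin k} → toℕ i < toℕ j → toℕ (Fin.opposite j) < toℕ (Fin.opposite i)
  reverses {i} {j} i<j rewrite Finₚ.opposite-prop i | Finₚ.opposite-prop j =
    ∸-monoʳ-< (s≤s i<j) (Finₚ.toℕ<n j)
  entry : ∀ i j → tri false true (toℕ (Fin.opposite i)) (toℕ (Fin.opposite j)) ≡ T k i j
  entry i j with <-cmp (toℕ i) (toℕ j)
  ... | tri< i<j _ _ = trans (tri-below (reverses i<j)) (sym (≤ᵇ-true (<⇒≤ i<j)))
  ... | tri≈ _ i≡j _ rewrite Finₚ.toℕ-injective i≡j =
    trans (tri-diagonal (toℕ (Fin.opposite j))) (sym (≤ᵇ-true (≤-refl {toℕ j})))
  ... | tri> _ _ j<i = trans (tri-above (reverses j<i)) (sym (≤ᵇ-false j<i))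

sumBelow : ℕ → (ℕ → ℕ) → ℕ
sumBelow zero    f = 0
sumBelow (suc r) f = f 0 + sumBelow r (f ∘ suc)

sumBelow-+ : ∀ r (f g h : ℕ → ℕ) → (∀ ρ → f ρ ≡ g ρ + h ρ) →
  sumBelow r f ≡ sumBelow r g + sumBelow r h
sumBelow-+ zero    f g h f≡g+h = refl
sumBelow-+ (suc r) f g h f≡g+h = begin
  f 0 + sumBelow r (f ∘ suc)
    ≡⟨ cong₂ _+_ (f≡g+h 0) (sumBelow-+ r (f ∘ suc) (g ∘ suc) (h ∘ suc) (f≡g+h ∘ suc)) ⟩
  (g 0 + h 0) + (sumBelow r (g ∘ suc) + sumBelow r (h ∘ suc))
    ≡⟨ +-interchange (g 0) (h 0) _ _ ⟩
  (g 0 + sumBelow r (g ∘ suc)) + (h 0 + sumBelow r (h ∘ suc)) ∎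
  where open ≡-Reasoning

sumBelow-≤ : ∀ r (f : ℕ → ℕ) B → (∀ ρ → ρ < r → f ρ ≤ B) → sumBelow r f ≤ r * B
sumBelow-≤ zero    f B bounded = z≤n
sumBelow-≤ (suc r) f B bounded =
  +-mono-≤ (bounded 0 (s≤s z≤n)) (sumBelow-≤ r (f ∘ suc) B (λ ρ ρ<r → bounded (suc ρ) (s≤s ρ<r)))

-- The Balogh–Bollobás bound below is 2^(2^exponent k): ladders of length 2^exponent k are thinned
-- to exponent k = 4(k+1) rungs, and two majority choices then leave k+1 of them.
exponent : ℕ → ℕ
exponent k = (suc k + suc k) + (suc k + suc k)

-- Columns of an arbitrary type C, each described by its entries `a d x` in the rows d = 0, 1, …;
-- the columns of a matrix and the classes of such columns are the two instances used below.

module Rows {C : Set} (a : ℕ → C → Bool) where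

  Agree : ℕ → ℕ → C → C → Set
  Agree j zero x y = ⊤
  Agree j (suc r) x y = a j x ≡ a j y × Agree (suc j) r x y

  Agree-sym : ∀ j r {x y} → Agree j r x y → Agree j r y x
  Agree-sym j zero _ = tt
  Agree-sym j (suc r) (e , ag) = sym e , Agree-sym (suc j) r ag

  Agree-trans : ∀ j r {x y z} → Agree j r x y → Agree j r y z → Agree j r x z
  Agree-trans j zero _ _ = tt
  Agree-trans j (suc r) (e , ag) (e′ , ag′) = trans e e′ , Agree-trans (suc j) r ag ag′

  Agree-at : ∀ j r {x y} → Agree j r x y → ∀ d → j ≤ d → d < j + r → a d x ≡ a d y
  Agree-at j zero _ d j≤d d<j = ⊥-elim (<-irrefl refl (<-≤-trans d<j (≤-trans (≤-reflexive (+-identityʳ j)) j≤d)))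
  Agree-at j (suc r) (e , ag) d j≤d d< with m≤n⇒m<n∨m≡n j≤d
  ... | inj₂ refl = e
  ... | inj₁ j<d = Agree-at (suc j) r ag d j<d (≤-trans d< (≤-reflexive (+-suc j r)))

  Separated : ℕ → ℕ → List C → Set
  Separated j r = AllPairs (λ x y → ¬ Agree j r x y)

  separated-zero : ∀ {j S} → Separated j zero S → length S ≤ 1
  separated-zero [] = z≤n
  separated-zero ([] ∷ []) = s≤s z≤n
  separated-zero ((¬ag ∷ _) ∷ _) = ⊥-elim (¬ag tt)

  separated-select : ∀ {j r} b S → Separated j (suc r) S → Separated (suc j) r (select (a j) b S)
  separated-select {j} b S sep =
    AllPairs-refine (λ ax≡b ay≡b ¬ag ag → ¬ag (trans ax≡b (sym ay≡b) , ag))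
      (select-sound (a j) b S) (AllPairs.filter⁺ _ sep)

  -- A ladder is a list of rungs u₁, u₂, … in which
  -- every later column has the entry `bit uᵢ` in row uᵢ, while column uᵢ itself has the other
  -- entry there.
  record Rung : Set where
    constructor rung
    field
      row : ℕ
      bit : Bool
      col : C
  open Rung public

  RungIn : ℕ → List C → Rung → Set
  RungIn E S u = row u < E × col u ∈ S × a (row u) (col u) ≡ not (bit u)

  Above : Rung → Rung → Set
  Above u v = a (row u) (col v) ≡ bit u

  Ladder : ℕ → List C → List Rung → Set
  Ladder E S zs = All (RungIn E S) zs × AllPairs Above zs

  ladder-widen : ∀ {j ρ zs} b S → Ladder (suc j + ρ) (select (a j) b S) zs → Ladder (j + suc ρ) S zs
  ladder-widen {j} {ρ} b S (rungs , above) = All.map widen-rung rungs , above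
    where
    widen-rung : ∀ {u} → RungIn (suc j + ρ) (select (a j) b S) u → RungIn (j + suc ρ) S u
    widen-rung (r< , x∈ , own) = <-≤-trans r< (≤-reflexive (sym (+-suc j ρ))) , proj₁ (select-∈ (a j) b S x∈) , own

  LadderOfLength : ℕ → ℕ → List C → Set
  LadderOfLength L E S = Σ (List Rung) λ zs → L ≤ length zs × Ladder E S zs

  widen : ∀ {L j ρ} b S → LadderOfLength L (suc j + ρ) (select (a j) b S) →
    LadderOfLength L (j + suc ρ) S
  widen b S (zs , len , lad) = zs , len , ladder-widen b S lad

  add-rung : ∀ {L j ρ y} b S → y ∈ select (a j) (not b) S →
    LadderOfLength L (suc j + ρ) (select (a j) b S) → LadderOfLength (suc L) (j + suc ρ) S
  add-rung {j = j} {ρ} {y} b S y∈minor (zs , len , lad@(rungs , above)) =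
    rung j b y ∷ zs , s≤s len , (top-in ∷ proj₁ (ladder-widen b S lad)) , (top-above ∷ above)
    where
    top-in : RungIn (j + suc ρ) S (rung j b y)
    top-in = m<m+n j (s≤s z≤n) , select-∈ (a j) (not b) S y∈minor
    top-above : All (Above (rung j b y)) zs
    top-above = All.map (λ (_ , x∈ , _) → proj₂ (select-∈ (a j) b S x∈)) rungs

  private
    empty-or-member : (xs : List C) → xs ≡ [] ⊎ Σ C (_∈ xs)
    empty-or-member [] = inj₁ refl
    empty-or-member (x ∷ _) = inj₂ (x , here refl)

  -- Split by the first row
  -- into a majority and a minority side; if the minority is nonempty, one of its columns gives
  -- a rung and the construction continues in the majority, which still has 2^(L-1) columns.
  ladder : ∀ ρ j L S → Separated j ρ S → 2 ^ L ≤ length S → LadderOfLength L (j + ρ) S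
  ladder zero j zero S sep big = [] , z≤n , [] , []
  ladder zero j (suc L) S sep big =
    ⊥-elim (<-irrefl refl (≤-trans (two≤2^suc L) (≤-trans big (separated-zero {j} sep))))
  ladder (suc ρ) j L S sep big with majority (a j) S
  ... | b , minor≤major with empty-or-member (select (a j) (not b) S) | L
  ...   | inj₂ _ | zero = [] , z≤n , [] , []
  ...   | inj₁ minor≡[] | L′ =
    widen b S (ladder ρ (suc j) L′ (select (a j) b S) (separated-select b S sep) major-big)
    where
    major-big : 2 ^ L′ ≤ length (select (a j) b S)
    major-big = ≤-trans big (≤-reflexive (begin
      length S
        ≡⟨ sym (select-length (a j) b S) ⟩
      length (select (a j) b S) + length (select (a j) (not b) S)
        ≡⟨ cong (λ l → length (select (a j) b S) + length l) minor≡[] ⟩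
      length (select (a j) b S) + 0
        ≡⟨ +-identityʳ _ ⟩
      length (select (a j) b S) ∎))
      where open ≡-Reasoning
  ...   | inj₂ (y , y∈minor) | suc L′ =
    add-rung b S y∈minor (ladder ρ (suc j) L′ (select (a j) b S) (separated-select b S sep) major-big)
    where
    major-big : 2 ^ L′ ≤ length (select (a j) b S)
    major-big = halve (≤-trans (≤-reflexive (sym (double L′)))
                         (≤-trans big (≤-reflexive (sym (select-length (a j) b S)))))
                      minor≤major

  record Embedding {k l} (F : Mat k l) (E : ℕ) (S : List C) : Set where
    field
      rowOf         : Fin k → ℕ
      colOf         : Fin l → C
      row-injective : Injective _≡_ _≡_ rowOf
      col-injective : Injective _≡_ _≡_ colOf
      row-bound     : ∀ i → rowOf i < E
      col-member    : ∀ j → colOf j ∈ S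
      entry         : ∀ i j → a (rowOf i) (colOf j) ≡ F i j

  -- For a matrix with distinct rows and distinct columns, injectivity of an embedding is automatic.
  embed : ∀ {k l E S} {F : Mat k l} → Simple F → Simple (transpose F) →
    (R : Fin k → ℕ) (K : Fin l → C) → (∀ i → R i < E) → (∀ j → K j ∈ S) →
    (∀ i j → a (R i) (K j) ≡ F i j) → Embedding F E S
  embed {F = F} F-simple Fᵀ-simple R K bound member entry = record
    { rowOf = R ; colOf = K
    ; row-injective = λ {i} {i′} Ri≡Ri′ → Fᵀ-simple i i′ λ j →
        trans (sym (entry i j)) (trans (cong (λ d → a d (K j)) Ri≡Ri′) (entry i′ j))
    ; col-injective = λ {j} {j′} Kj≡Kj′ → F-simple j j′ λ i →
        trans (sym (entry i j)) (trans (cong (a (R i)) Kj≡Kj′) (entry i j′))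
    ; row-bound = bound ; col-member = member ; entry = entry }

  restrict : ∀ {k l k′ l′ E S} {F : Mat k l} {G : Mat k′ l′} → F ≺ G → Embedding G E S → Embedding F E S
  restrict (r , c , r-inj , c-inj , same) e = record
    { rowOf = rowOf ∘ r ; colOf = colOf ∘ c
    ; row-injective = r-inj ∘ row-injective ; col-injective = c-inj ∘ col-injective
    ; row-bound = row-bound ∘ r ; col-member = col-member ∘ c
    ; entry = λ i j → trans (entry (r i) (c j)) (same i j) }
    where open Embedding e

  Pattern : ℕ → ℕ → List C → Set
  Pattern k E S = Embedding (I k) E S ⊎ Embedding (Iᶜ k) E S ⊎ Embedding (T k) E S

  tri-pattern : ∀ P Γ {k E S} → Embedding (Tri P Γ (suc k)) E S → Pattern k E S
  tri-pattern false false {k} e = inj₁ (restrict (I-in-Tri k) (restrict (Tri-shrink k) e))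
  tri-pattern true  true  {k} e = inj₂ (inj₁ (restrict (Iᶜ-in-Tri k) (restrict (Tri-shrink k) e)))
  tri-pattern true  false {k} e = inj₂ (inj₂ (restrict (T-in-Tri-above k) e))
  tri-pattern false true  {k} e = inj₂ (inj₂ (restrict (T-in-Tri-below k) (restrict (Tri-shrink k) e)))

  triangle : ∀ {B : Set} (R : B → ℕ) (K : B → C) P Γ ℓ {E S} (ws : List B) → ℓ ≤ length ws →
    All (λ w → R w < E × K w ∈ S × a (R w) (K w) ≡ not P) ws →
    AllPairs (λ w w′ → a (R w) (K w′) ≡ P) ws →
    AllPairs (λ w w′ → a (R w′) (K w) ≡ Γ) ws →
    Embedding (Tri P Γ ℓ) E S
  triangle {B} R K P Γ ℓ {E} {S} ws ℓ≤ cells upper lower =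
    embed Tri-simple Tri-rows-simple (R ∘ cell) (K ∘ cell)
      (λ x → proj₁ (own x)) (λ x → proj₁ (proj₂ (own x))) entry
    where
    position : Fin ℓ → Fin (length ws)
    position x = Fin.inject≤ x ℓ≤
    cell : Fin ℓ → B
    cell = lookup ws ∘ position
    own : ∀ x → R (cell x) < E × K (cell x) ∈ S × a (R (cell x)) (K (cell x)) ≡ not P
    own x = All.lookup cells (∈-lookup (position x))
    position-< : ∀ {x y} → toℕ x < toℕ y → position x Fin.< position y
    position-< {x} {y} x<y rewrite Finₚ.toℕ-inject≤ x ℓ≤ | Finₚ.toℕ-inject≤ y ℓ≤ = x<y
    entry : ∀ x y → a (R (cell x)) (K (cell y)) ≡ Tri P Γ ℓ x y
    entry x y with <-cmp (toℕ x) (toℕ y)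
    ... | tri< x<y _ _ = trans (AllPairs-lookup upper (position-< x<y)) (sym (tri-above x<y))
    ... | tri> _ _ y<x = trans (AllPairs-lookup lower (position-< y<x)) (sym (tri-below y<x))
    ... | tri≈ _ x≡y _ rewrite Finₚ.toℕ-injective x≡y =
      trans (proj₂ (proj₂ (own y))) (sym (tri-diagonal (toℕ y)))

  -- A ladder of length 2^M is thinned (Ramsey) so that also the cells below the diagonal
  -- depend only on their column's rung; two majority choices then fix the bit (P) and that
  -- colour (Γ) on k+1 rungs, which form a triangle matrix.
  unavoidable : ∀ k j ρ S → Separated j ρ S → 2 ^ (2 ^ exponent k) ≤ length S → Pattern k (j + ρ) S
  unavoidable k j ρ S sep big = from-ladder (ladder ρ j (2 ^ exponent k) S sep big)
    where
    below : Rung → Rung → Bool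
    below u v = a (row v) (col u)

    from-ladder : LadderOfLength (2 ^ exponent k) (j + ρ) S → Pattern k (j + ρ) S
    from-ladder (zs , long , rungs , above) =
      from-thinned (ramsey below (exponent k) zs (≤-trans long (n≤1+n _)))
      where
      from-thinned : Thinned below (exponent k) zs → Pattern k (j + ρ) S
      from-thinned (ys , M≤ , ys⊆zs , lower) with majority-large (bit ∘ proj₁) ys M≤
      ... | P , big₁ with majority-large proj₂ (select (bit ∘ proj₁) P ys) big₁
      ... | Γ , big₂ =
        tri-pattern P Γ (triangle (row ∘ proj₁) (col ∘ proj₁) P Γ (suc k) ys₂ big₂ cells upper lower₂)
        where
        ys₂ : List (Rung × Bool)
        ys₂ = select proj₂ Γ (select (bit ∘ proj₁) P ys)
        keep : ∀ {Q : Rung × Bool → Set} → All Q ys → All Q ys₂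
        keep = All.filter⁺ _ ∘ All.filter⁺ _
        keep-pairs : ∀ {R : Rung × Bool → Rung × Bool → Set} → AllPairs R ys → AllPairs R ys₂
        keep-pairs = AllPairs.filter⁺ _ ∘ AllPairs.filter⁺ _
        bit≡P : All (λ w → bit (proj₁ w) ≡ P) ys₂
        bit≡P = All.filter⁺ _ (select-sound (bit ∘ proj₁) P ys)
        colour≡Γ : All (λ w → proj₂ w ≡ Γ) ys₂
        colour≡Γ = select-sound proj₂ Γ (select (bit ∘ proj₁) P ys)
        cells : All (λ w → row (proj₁ w) < j + ρ × col (proj₁ w) ∈ S ×
                           a (row (proj₁ w)) (col (proj₁ w)) ≡ not P) ys₂
        cells = All.zipWith (λ ((r< , x∈ , own) , b≡P) → r< , x∈ , trans own (cong not b≡P))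
                  (keep (All.map⁻ (All-resp-⊆ ys⊆zs rungs)) , bit≡P)
        upper : AllPairs (λ w w′ → a (row (proj₁ w)) (col (proj₁ w′)) ≡ P) ys₂
        upper = AllPairs-refine (λ b≡P _ e → trans e b≡P) bit≡P
                  (keep-pairs (AllPairs.map⁻ (AllPairs-resp-⊆ ys⊆zs above)))
        lower₂ : AllPairs (λ w w′ → a (row (proj₁ w′)) (col (proj₁ w)) ≡ Γ) ys₂
        lower₂ = AllPairs-refine (λ γ≡Γ _ e → trans e γ≡Γ) colour≡Γ (keep-pairs lower)

-- The classes of the columns S under agreement on the rows j, …, j+ρ-1, keeping only those with
-- at least t members; a class is stored as a representative together with the other members.
module Classes {C : Set} (a : ℕ → C → Bool) (t : ℕ) where
  open Rows a

  Class : Set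
  Class = C × List C

  rep : Class → C
  rep = proj₁

  members : Class → List C
  members (x , xs) = x ∷ xs

  classes : ℕ → ℕ → List C → List Class
  classes zero j [] = []
  classes zero j (x ∷ xs) with t ≤? suc (length xs)
  ... | yes _ = (x , xs) ∷ []
  ... | no _  = []
  classes (suc ρ) j S =
    classes ρ (suc j) (select (a j) false S) ++ classes ρ (suc j) (select (a j) true S)

  classes-large : ∀ ρ j S → All (λ g → t ≤ length (members g)) (classes ρ j S)
  classes-large zero j [] = []
  classes-large zero j (x ∷ xs) with t ≤? suc (length xs)
  ... | yes large = large ∷ []
  ... | no _      = []
  classes-large (suc ρ) j S = All.++⁺ (classes-large ρ (suc j) _) (classes-large ρ (suc j) _)

  classes-within : ∀ ρ j S →
    All (λ g → All (λ y → y ∈ S × Agree j ρ (rep g) y) (members g)) (classes ρ j S)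
  classes-within zero j [] = []
  classes-within zero j (x ∷ xs) with t ≤? suc (length xs)
  ... | yes _ = All.tabulate (λ y∈ → y∈ , tt) ∷ []
  ... | no _  = []
  classes-within (suc ρ) j S = All.++⁺ (side false) (side true)
    where
    side : ∀ b → All (λ g → All (λ y → y ∈ S × Agree j (suc ρ) (rep g) y) (members g))
                     (classes ρ (suc j) (select (a j) b S))
    side b = All.map widen-class (classes-within ρ (suc j) (select (a j) b S))
      where
      -- the representative and every member have the entry b in row j
      widen-class : ∀ {g} → All (λ y → y ∈ select (a j) b S × Agree (suc j) ρ (rep g) y) (members g) →
                            All (λ y → y ∈ S × Agree j (suc ρ) (rep g) y) (members g)
      widen-class within@((rep∈ , _) ∷ _) = All.map (λ (y∈ , ag) →
        proj₁ (select-∈ (a j) b S y∈) ,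
        trans (proj₂ (select-∈ (a j) b S rep∈)) (sym (proj₂ (select-∈ (a j) b S y∈))) , ag) within

  classes-separated : ∀ ρ j S → AllPairs (λ g h → ¬ Agree j ρ (rep g) (rep h)) (classes ρ j S)
  classes-separated zero j [] = []
  classes-separated zero j (x ∷ xs) with t ≤? suc (length xs)
  ... | yes _ = [] ∷ []
  ... | no _  = []
  classes-separated (suc ρ) j S =
    AllPairs.++⁺ (within-side false) (within-side true)
      (All.map (λ rep₀ → All.map (λ rep₁ (same , _) → not-≢ (trans (sym rep₀) (trans same rep₁)))
                                 (rep-side true))
               (rep-side false))
    where
    within-side : ∀ b → AllPairs (λ g h → ¬ Agree j (suc ρ) (rep g) (rep h))
                                 (classes ρ (suc j) (select (a j) b S))
    within-side b = AllPairs.map (λ ¬ag (_ , ag) → ¬ag ag) (classes-separated ρ (suc j) _)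
    rep-side : ∀ b → All (λ g → a j (rep g) ≡ b) (classes ρ (suc j) (select (a j) b S))
    rep-side b = All.map (λ { ((rep∈ , _) ∷ _) → proj₂ (select-∈ (a j) b S rep∈) })
      (classes-within ρ (suc j) (select (a j) b S))

  classes-distinct : ∀ ρ j S → Unique S → All (Unique ∘ members) (classes ρ j S)
  classes-distinct zero j [] _ = []
  classes-distinct zero j (x ∷ xs) distinct with t ≤? suc (length xs)
  ... | yes _ = distinct ∷ []
  ... | no _  = []
  classes-distinct (suc ρ) j S distinct =
    All.++⁺ (classes-distinct ρ (suc j) _ (AllPairs.filter⁺ _ distinct))
            (classes-distinct ρ (suc j) _ (AllPairs.filter⁺ _ distinct))

  -- Counting the columns through their large classes: if S has at least t columns it is itself
  -- the large class of depth 0, and its two sides by row j are counted by induction.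
  count : 1 ≤ t → ∀ r j S → Separated j r S →
    length S ≤ t + t * sumBelow r (λ ρ → length (classes ρ j S))
  count 1≤t zero j S sep = ≤-trans (separated-zero {j} sep) (≤-trans 1≤t (m≤m+n t _))
  count 1≤t (suc r) j [] sep = z≤n
  count 1≤t (suc r) j (x ∷ xs) sep with t ≤? suc (length xs)
  ... | no small = ≤-trans (<⇒≤ (≰⇒> small)) (m≤m+n t _)
  ... | yes _ = begin
    length S
      ≡⟨ sym (select-length (a j) false S) ⟩
    length S₀ + length S₁
      ≤⟨ +-mono-≤ (count 1≤t r (suc j) S₀ (separated-select false S sep))
                  (count 1≤t r (suc j) S₁ (separated-select true S sep)) ⟩
    (t + t * Σ₀) + (t + t * Σ₁)
      ≡⟨ regroup t Σ₀ Σ₁ ⟩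
    t + t * (1 + (Σ₀ + Σ₁))
      ≡⟨ cong (λ σ → t + t * (1 + σ)) (sym (sumBelow-+ r _ _ _ λ ρ → length-++ (classes ρ (suc j) S₀))) ⟩
    t + t * (1 + sumBelow r (λ ρ → length (classes (suc ρ) j S))) ∎
    where
    open ≤-Reasoning
    S S₀ S₁ : List C
    S = x ∷ xs
    S₀ = select (a j) false S
    S₁ = select (a j) true S
    Σ₀ Σ₁ : ℕ
    Σ₀ = sumBelow r (λ ρ → length (classes ρ (suc j) S₀))
    Σ₁ = sumBelow r (λ ρ → length (classes ρ (suc j) S₁))
    regroup : ∀ t σ₀ σ₁ → (t + t * σ₀) + (t + t * σ₁) ≡ t + t * (1 + (σ₀ + σ₁))
    regroup = solve-∀

-- The rows of an m × n matrix as a row function on ℕ; rows from m on are taken to be zero.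
rowsOf : ∀ {m n} → Mat m n → ℕ → Fin n → Bool
rowsOf {m} A d x with d <? m
... | yes d<m = A (Fin.fromℕ< d<m) x
... | no _    = false

rowsOf-below : ∀ {m n} (A : Mat m n) {d} (d<m : d < m) x → rowsOf A d x ≡ A (Fin.fromℕ< d<m) x
rowsOf-below {m} A {d} d<m x with d <? m
... | yes _   = refl
... | no d≮m = ⊥-elim (d≮m d<m)

rowsOf-toℕ : ∀ {m n} (A : Mat m n) i x → rowsOf A (toℕ i) x ≡ A i x
rowsOf-toℕ A i x =
  trans (rowsOf-below A (Finₚ.toℕ<n i) x) (cong (λ r → A r x) (Finₚ.fromℕ<-toℕ i (Finₚ.toℕ<n i)))

-- For an m-rowed simple matrix A avoiding t·I_k, t·I_k^c and t·T_k, at every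
-- depth ρ < m there are few large classes: their representatives are distinguished by the first
-- ρ rows, so many of them would contain I_k, I_k^c or T_k, and the t members of each class then
-- give t copies of it.
module UpperBound {m n : ℕ} (A : Mat m n) (t : ℕ) where
  open Rows (rowsOf A)
  open Classes (rowsOf A) t

  columns : List (Fin n)
  columns = allFin n

  columns-separated : Simple A → Separated 0 m columns
  columns-separated simple =
    AllPairs.map (λ x≢y ag → x≢y (simple _ _ λ i → same-row ag i)) (allFin⁺ n)
    where
    same-row : ∀ {x y} → Agree 0 m x y → ∀ i → A i x ≡ A i y
    same-row {x} {y} ag i = begin
      A i x              ≡⟨ sym (rowsOf-toℕ A i x) ⟩
      rowsOf A (toℕ i) x ≡⟨ Agree-at 0 m ag (toℕ i) z≤n (Finₚ.toℕ<n i) ⟩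
      rowsOf A (toℕ i) y ≡⟨ rowsOf-toℕ A i y ⟩
      A i y              ∎
      where open ≡-Reasoning

  -- An embedding of F into the representatives of the large classes of depth ρ < m lifts to an
  -- embedding of t · F into A: copy q of column j uses the q-th member of the class of column j.
  lift : ∀ {k l} {F : Mat k l} ρ → ρ < m → Embedding F ρ (map rep (classes ρ 0 columns)) → (t · F) ≺ A
  lift {k} {l} {F} ρ ρ<m e = lifted-row , lifted-col , lifted-row-injective , lifted-col-injective , entry′
    where
    open Embedding e
    G : List Class
    G = classes ρ 0 columns

    class-of : Fin l → Class
    class-of j = proj₁ (∈-map⁻ rep (col-member j))
    class∈ : ∀ j → class-of j ∈ G
    class∈ j = proj₁ (proj₂ (∈-map⁻ rep (col-member j)))
    col≡rep : ∀ j → colOf j ≡ rep (class-of j)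
    col≡rep j = proj₂ (proj₂ (∈-map⁻ rep (col-member j)))

    position : ∀ j → Fin t → Fin (length (members (class-of j)))
    position j q = Fin.inject≤ q (All.lookup (classes-large ρ 0 columns) (class∈ j))

    member : Fin l → Fin t → Fin n
    member j q = lookup (members (class-of j)) (position j q)

    member-agrees : ∀ j q → Agree 0 ρ (colOf j) (member j q)
    member-agrees j q = subst (λ x → Agree 0 ρ x (member j q)) (sym (col≡rep j))
      (proj₂ (All.lookup (All.lookup (classes-within ρ 0 columns) (class∈ j)) (∈-lookup (position j q))))

    same-class : ∀ {j j′ q q′} → member j q ≡ member j′ q′ → j ≡ j′
    same-class {j} {j′} {q} {q′} same = col-injective
      (AllPairs-collapse (Agree-sym 0 ρ) (AllPairs.map⁺ (classes-separated ρ 0 columns))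
        (col-member j) (col-member j′)
        (Agree-trans 0 ρ (member-agrees j q)
          (subst (λ x → Agree 0 ρ x (colOf j′)) (sym same) (Agree-sym 0 ρ (member-agrees j′ q′)))))

    member-injective : ∀ {j j′ q q′} → member j q ≡ member j′ q′ → j ≡ j′ × q ≡ q′
    member-injective {j} {j′} {q} {q′} same with same-class {q = q} {q′} same
    ... | refl = refl , Finₚ.inject≤-injective _ _ q q′
      (lookup-injective (All.lookup (classes-distinct ρ 0 columns (allFin⁺ n)) (class∈ j)) same)

    lifted-col : Fin (t * l) → Fin n
    lifted-col jj = member (Fin.remainder {t} l jj) (Fin.quotient {t} l jj)

    lifted-col-injective : Injective _≡_ _≡_ lifted-col
    lifted-col-injective {jj} {jj′} same with member-injective same
    ... | r≡r′ , q≡q′ = begin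
      jj                                                            ≡⟨ sym (Finₚ.combine-remQuot {t} l jj) ⟩
      Fin.combine (Fin.quotient {t} l jj) (Fin.remainder {t} l jj)   ≡⟨ cong₂ Fin.combine q≡q′ r≡r′ ⟩
      Fin.combine (Fin.quotient {t} l jj′) (Fin.remainder {t} l jj′) ≡⟨ Finₚ.combine-remQuot {t} l jj′ ⟩
      jj′                                                           ∎
      where open ≡-Reasoning

    row-below : ∀ i → rowOf i < m
    row-below i = <-trans (row-bound i) ρ<m

    lifted-row : Fin k → Fin m
    lifted-row i = Fin.fromℕ< (row-below i)

    lifted-row-injective : Injective _≡_ _≡_ lifted-row
    lifted-row-injective {i} {i′} same = row-injective
      (trans (sym (Finₚ.toℕ-fromℕ< (row-below i))) (trans (cong toℕ same) (Finₚ.toℕ-fromℕ< (row-below i′))))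

    entry′ : ∀ i jj → A (lifted-row i) (lifted-col jj) ≡ (t · F) i jj
    entry′ i jj = begin
      A (lifted-row i) (lifted-col jj)               ≡⟨ sym (rowsOf-below A (row-below i) (lifted-col jj)) ⟩
      rowsOf A (rowOf i) (lifted-col jj)      ≡⟨ sym (Agree-at 0 ρ (member-agrees r q) (rowOf i) z≤n (row-bound i)) ⟩
      rowsOf A (rowOf i) (colOf r)     ≡⟨ entry i r ⟩
      F i r                            ∎
      where
      open ≡-Reasoning
      r = Fin.remainder {t} l jj
      q = Fin.quotient {t} l jj

  module _ (k : ℕ) (simple : Simple A)
    (no-I : ¬ ((t · I k) ≺ A)) (no-Iᶜ : ¬ ((t · Iᶜ k) ≺ A)) (no-T : ¬ ((t · T k) ≺ A)) where

    classes-few : ∀ ρ → ρ < m → length (classes ρ 0 columns) ≤ 2 ^ (2 ^ exponent k)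
    classes-few ρ ρ<m = ≮⇒≥ λ many → excluded (unavoidable k 0 ρ representatives
      (AllPairs.map⁺ (classes-separated ρ 0 columns))
      (≤-trans (<⇒≤ many) (≤-reflexive (sym (length-map rep (classes ρ 0 columns))))))
      where
      representatives : List (Fin n)
      representatives = map rep (classes ρ 0 columns)
      excluded : Pattern k ρ representatives → ⊥
      excluded (inj₁ e)        = no-I (lift ρ ρ<m e)
      excluded (inj₂ (inj₁ e)) = no-Iᶜ (lift ρ ρ<m e)
      excluded (inj₂ (inj₂ e)) = no-T (lift ρ ρ<m e)

    upper-bound : 1 ≤ t → 1 ≤ m → n ≤ t * suc (2 ^ (2 ^ exponent k)) * m
    upper-bound 1≤t (s≤s {n = m′} _) = begin
      n                                                  ≡⟨ sym (length-tabulate (λ x → x)) ⟩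
      length columns                                     ≤⟨ count 1≤t m 0 columns (columns-separated simple) ⟩
      t + t * sumBelow m (λ ρ → length (classes ρ 0 columns))
        ≤⟨ +-monoʳ-≤ t (*-monoʳ-≤ t (sumBelow-≤ m _ N classes-few)) ⟩
      t + t * (m * N)                                    ≤⟨ m≤m+n _ (t * m′) ⟩
      (t + t * (m * N)) + t * m′                         ≡⟨ expand t N m′ ⟩
      t * suc N * m                                      ∎
      where
      open ≤-Reasoning
      N : ℕ
      N = 2 ^ (2 ^ exponent k)
      expand : ∀ t N m′ → (t + t * ((1 + m′) * N)) + t * m′ ≡ t * (1 + N) * (1 + m′)
      expand = solve-∀

-- The lower bound: the identity matrix I_m is simple and, for t ≥ 2, contains no t · F with F
-- having a 1 — two copies of that 1 would need two columns of I_m with a 1 in the same row.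

I-one : ∀ {m} {x y : Fin m} → I m x y ≡ true → x ≡ y
I-one {x = x} {y} one with x Fin.≟ y
I-one {x = x} {y} one | yes x≡y = x≡y
I-one {x = x} {y} ()  | no _

identity-simple : ∀ m → Simple (I m)
identity-simple m j j′ same = I-one (trans (sym (same j)) diagonal)
  where
  diagonal : I m j j ≡ true
  diagonal with j Fin.≟ j
  ... | yes _  = refl
  ... | no j≢j = ⊥-elim (j≢j refl)

identity-avoids : ∀ {t k l} m (F : Mat k l) → 2 ≤ t → ∀ i j → F i j ≡ true → ¬ ((t · F) ≺ I m)
identity-avoids {suc (suc t′)} {l = l} m F (s≤s (s≤s _)) i j one (r , c , r-injective , c-injective , same) =
  first≢second (Finₚ.combine-injectiveˡ first j second j
    (c-injective (trans (sym (hits first)) (hits second))))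
  where
  first second : Fin (suc (suc t′))
  first  = Fin.zero
  second = Fin.suc Fin.zero
  first≢second : ¬ first ≡ second
  first≢second ()
  -- every copy of column j of F meets row r i in a 1 of I_m
  hits : ∀ q → r i ≡ c (Fin.combine q j)
  hits q = I-one (trans (same i (Fin.combine q j))
                        (trans (cong (F i ∘ proj₂) (Finₚ.remQuot-combine {k = l} q j)) one))

theorem8 : (t k : ℕ) → 2 ≤ t → 2 ≤ k →
    Σ ℕ λ c₁ → Σ ℕ λ c₂ → Σ ℕ λ m₀ → (m : ℕ) → m₀ ≤ m →
      ((n : ℕ) (A : Mat m n) → Simple A →
        ¬ ((t · I k) ≺ A) → ¬ ((t · Iᶜ k) ≺ A) → ¬ ((t · T k) ≺ A) →
        n ≤ c₂ * m)
      ×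
      (Σ ℕ λ n → Σ (Mat m n) λ A → Simple A ×
        ¬ ((t · I k) ≺ A) × ¬ ((t · Iᶜ k) ≺ A) × ¬ ((t · T k) ≺ A) ×
        m ≤ c₁ * n)
theorem8 t k 2≤t (s≤s (s≤s _)) = 1 , t * suc (2 ^ (2 ^ exponent k)) , 1 , λ m 1≤m →
  (λ n A simple no-I no-Iᶜ no-T →
     UpperBound.upper-bound A t k simple no-I no-Iᶜ no-T (≤-trans (s≤s z≤n) 2≤t) 1≤m) ,
  (m , I m , identity-simple m ,
   identity-avoids m (I k) 2≤t Fin.zero Fin.zero refl ,
   identity-avoids m (Iᶜ k) 2≤t Fin.zero (Fin.suc Fin.zero) refl ,
   identity-avoids m (T k) 2≤t Fin.zero Fin.zero refl ,
   ≤-reflexive (sym (*-identityˡ m)))
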